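{- Let $\mathbb{S}$ be a singular genome, $\mathbb{D}$ a duplicated genome over the same families, $\check{\mathbb{D}}$ a singularization of $\mathbb{D}$, and $k\in\{2,4,6,\dots\}\cup\{\infty\}$. Then every 0-path and every 2-cycle of the ambiguous breakpoint graph $ABG(\mathbb{S},\check{\mathbb{D}})$ is optimal for the $\sigma_k$ disambiguation, i.e. it is contained (as a component) in $BG(\tau,\check{\mathbb{D}})$ for every optimal solution $\tau$ of the $\sigma_k$ disambiguation.
   Context: Genomes: genes belong to families $\mathtt{X}$ and have extremities $\mathtt{X}^h,\mathtt{X}^t$; chromosomes are linear or circular sequences of oriented genes; an adjacency is the unordered pair of neighbouring extremities of consecutive genes (circularly for circular chromosomes), a telomere is an extremity at an end of a linear chromosome. A genome is singular (each family once) or duplicated (each family twice). A singularization of a duplicated genome labels the two occurrences of each family $\mathtt{X}$ as $\mathtt{X}_a$ and $\mathtt{X}_b$. For an extremity $\gamma$ of family $\mathtt{X}$ write $\gamma_a,\gamma_b$ for the corresponding extremities of $\mathtt{X}_a,\mathtt{X}_b$; these two vertices are called paralogous, and $\hat u$ denotes the paralog of $u$. Ambiguous breakpoint graph $ABG(\mathbb{S},\check{\mathbb{D}})$: vertices are all extremities $\mathtt{X}_a^h,\mathtt{X}_b^h,\mathtt{X}_a^t,\mathtt{X}_b^t$ for the families $\mathtt{X}$ of $\mathbb{S}$. For each adjacency of $\check{\mathbb{D}}$ there is a $\check{\mathbb{D}}$-edge joining its two extremities. For each adjacency $\gamma\beta$ of $\mathbb{S}$ there is a square consisting of four $\mathbb{S}$-edges,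 split into the pair $\mathcal{E}=\{\gamma_a\beta_a,\gamma_b\beta_b\}$ and the complementary pair $\tilde{\mathcal{E}}=\{\gamma_a\beta_b,\gamma_b\beta_a\}$. $\mathbb{S}$-telomeres are the vertices $\gamma_a,\gamma_b$ for telomeres $\gamma$ of $\mathbb{S}$; $\check{\mathbb{D}}$-telomeres are the telomeres of $\check{\mathbb{D}}$. A solution $\tau$ chooses for each square one of its two pairs ($\mathcal{E}$ or $\tilde{\mathcal{E}}$); $BG(\tau,\check{\mathbb{D}})$ is the graph on the same vertices with all $\check{\mathbb{D}}$-edges and the chosen $\mathbb{S}$-edges. Its components are even cycles and paths; with $c_i$ the number of cycles with $i$ edges and $p_j$ the number of paths with $j$ edges, the $k$-score of $\tau$ is $\sigma_k=c_2+c_4+\dots+c_k+\frac{p_0+p_2+\dots+p_{k-2}}{2}$ (for $k=\infty$: total number of cycles plus half the number of even-length paths). The $\sigma_k$ disambiguation asks for a solution of maximum $k$-score (an optimal solution). A 2-cycle of $ABG(\mathbb{S},\check{\mathbb{D}})$ is a $\check{\mathbb{D}}$-edge $uv$ together with an $\mathbb{S}$-edge joining $u$ and $v$. A 0-path is a vertex that is both an $\mathbb{S}$-telomere and a $\check{\mathbb{D}}$-telomere (an isolated vertex). -}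

module Defs where

open import Data.Nat using (ℕ; zero; suc; _+_; _*_; _≤_; _≤ᵇ_)
open import Data.Bool using (Bool; true; false; if_then_else_; _∧_)
open import Data.Fin using (Fin; toℕ)
open import Data.Fin.Properties using (_≟_)
open import Data.Maybe using (Maybe; just; nothing)
open import Data.List using (List; []; _∷_; length; map; concatMap; _++_; foldr; allFin)
open import Data.Nat.ListAction using (sum)
open import Data.Product using (_×_; _,_; ∃-syntax)
open import Relation.Binary.PropositionalEquality using (_≡_; _≢_)
open import Relation.Nullary using (yes; no)

data End : Set where
  h t : End

data Copy : Set where
  a b : Copy       -- the two occurrences X_a, X_b of a family X

flipC : Copy → Copy
flipC a = b
flipC b = a

Ext : ℕ → Set
Ext n = Fin n × End

-- vertices of ABG(S, Ď): extremities X_a^h, X_b^h, X_a^t, X_b^t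
Vert : ℕ → Set
Vert n = Fin n × Copy × End

ext : ∀ {n} → Vert n → Ext n
ext (x , _ , e) = x , e

-- Genomes, represented by their sets of adjacencies.
-- A set of adjacencies on extremities is a matching: every extremity
-- lies in at most one adjacency (unmatched extremities are telomeres).
-- Every such matching is the adjacency set of a genome (the genes plus
-- the adjacencies form disjoint paths/cycles = linear/circular
-- chromosomes), and conversely.

record Matching (V : Set) : Set where
  field
    partner : V → Maybe V
    partner-sym : ∀ {u v} → partner u ≡ just v → partner v ≡ just u
    partner-irrefl : ∀ u → partner u ≢ just u
open Matching public

SingGenome : ℕ → Set
SingGenome n = Matching (Ext n)

SingularizedDupGenome : ℕ → Set
SingularizedDupGenome n = Matching (Vert n)

-- Solutions: for each adjacency γβ of S (i.e. each square) choose
-- 𝓔 = {γ_aβ_a, γ_bβ_b}  (true)  or  𝓔̃ = {γ_aβ_b, γ_bβ_a}  (false).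
-- Stored on extremities, equal on both extremities of an adjacency.

record Solution {n} (S : SingGenome n) : Set where
  field
    choice : Ext n → Bool
    consistent : ∀ {γ β} → partner S γ ≡ just β → choice γ ≡ choice β
open Solution public

sEdge : ∀ {n} (S : SingGenome n) → Solution S → Vert n → Maybe (Vert n)
sEdge S τ (x , c , e) with partner S (x , e)
... | nothing = nothing
... | just (y , e') = just (y , (if choice τ (x , e) then c else flipC c) , e')

_==E_ : End → End → Bool
h ==E h = true
t ==E t = true
_ ==E _ = false

_==C_ : Copy → Copy → Bool
a ==C a = true
b ==C b = true
_ ==C _ = false

_==V_ : ∀ {n} → Vert n → Vert n → Bool
(x , c , e) ==V (y , c' , e') with x ≟ y
... | yes _ = (c ==C c') ∧ (e ==E e')
... | no _ = false

-- injective numbering of vertices, used to pick a representative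
cIdx : Copy → ℕ
cIdx a = 0
cIdx b = 1

eIdx : End → ℕ
eIdx h = 0
eIdx t = 1

key : ∀ {n} → Vert n → ℕ
key (x , c , e) = 4 * toℕ x + 2 * cIdx c + eIdx e

allVerts : ∀ n → List (Vert n)
allVerts n = concatMap (λ x → (x , a , h) ∷ (x , a , t) ∷ (x , b , h) ∷ (x , b , t) ∷ []) (allFin n)

data Side : Set where
  dSide sSide : Side

other : Side → Side
other dSide = sSide
other sSide = dSide

data Walk (V : Set) : Set where
  closed  : List V → Walk V
  stopped : List V → Walk V

consW : ∀ {V} → V → Walk V → Walk V
consW w (closed l) = closed (w ∷ l)
consW w (stopped l) = stopped (w ∷ l)

record CompInfo (n : ℕ) : Set where
  constructor info
  field
    isCycle : Bool
    edges   : ℕ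
    verts   : List (Vert n)

module _ {n : ℕ} (d s : Vert n → Maybe (Vert n)) where

  edgeOn : Side → Vert n → Maybe (Vert n)
  edgeOn dSide = d
  edgeOn sSide = s

  -- alternating walk from cur, first using side m; lists the vertices
  -- visited after the start v0
  walk : ℕ → Vert n → Vert n → Side → Walk (Vert n)
  walk zero v0 cur m = stopped []
  walk (suc f) v0 cur m with edgeOn m cur
  ... | nothing = stopped []
  ... | just w = if w ==V v0 then closed [] else consW w (walk f v0 w (other m))

  fuel : ℕ
  fuel = 4 * n

  compOf : Vert n → CompInfo n
  compOf v with walk fuel v v dSide
  ... | closed l = info true (suc (length l)) (v ∷ l)
  ... | stopped l with walk fuel v v sSide
  ...   | closed l' = info true (suc (length l')) (v ∷ l')
  ...   | stopped l' = info false (length l + length l') (v ∷ l ++ l')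

  isRep : Vert n → Bool
  isRep v = foldr (λ w r → (key v ≤ᵇ key w) ∧ r) true (CompInfo.verts (compOf v))

data KParam : Set where
  fin : ℕ → KParam
  ∞   : KParam

ValidK : KParam → Set
ValidK (fin k) = ∃[ m ] k ≡ 2 * suc m
ValidK ∞ = Data.Unit.⊤
  where import Data.Unit

evenᵇ : ℕ → Bool
evenᵇ zero = true
evenᵇ (suc zero) = false
evenᵇ (suc (suc j)) = evenᵇ j

cycleCounts : KParam → ℕ → Bool
cycleCounts (fin k) L = L ≤ᵇ k
cycleCounts ∞ L = true

-- path with j edges counts (with weight 1/2) iff j even and j ≤ k - 2
pathCounts : KParam → ℕ → Bool
pathCounts (fin k) j = evenᵇ j ∧ (j + 2 ≤ᵇ k)
pathCounts ∞ j = evenᵇ j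

-- contribution of one component to 2·σ_k
contrib2 : ∀ {n} → KParam → CompInfo n → ℕ
contrib2 k (info true L _) = if cycleCounts k L then 2 else 0
contrib2 k (info false j _) = if pathCounts k j then 1 else 0

-- 2·σ_k of the graph d ∪ s on Vert n (each component counted once,
-- at its representative vertex)
twiceScoreG : ∀ {n} → KParam → (d s : Vert n → Maybe (Vert n)) → ℕ
twiceScoreG {n} k d s =
  sum (map (λ v → if isRep d s v then contrib2 k (compOf d s v) else 0) (allVerts n))

twiceScore : ∀ {n} → KParam → (S : SingGenome n) → SingularizedDupGenome n → Solution S → ℕ
twiceScore k S D τ = twiceScoreG k (partner D) (sEdge S τ)

Optimal : ∀ {n} → KParam → (S : SingGenome n) → SingularizedDupGenome n → Solution S → Set
Optimal k S D τ = ∀ (τ' : Solution S) → twiceScore k S D τ' ≤ twiceScore k S D τ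

ZeroPath : ∀ {n} → SingGenome n → SingularizedDupGenome n → Vert n → Set
ZeroPath S D v = (partner S (ext v) ≡ nothing) × (partner D v ≡ nothing)

-- Ď-edge uv together with an S-edge of ABG joining u and v
-- (the square of adjacency γβ contains S-edges between all γ_x, β_y)
TwoCycle : ∀ {n} → SingGenome n → SingularizedDupGenome n → Vert n → Vert n → Set
TwoCycle S D u v = (partner D u ≡ just v) × (partner S (ext u) ≡ just (ext v))

IsolatedInBG : ∀ {n} (S : SingGenome n) → SingularizedDupGenome n → Solution S → Vert n → Set
IsolatedInBG S D τ v = (partner D v ≡ nothing) × (sEdge S τ v ≡ nothing)

-- the Ď-edge uv and the S-edge uv both belong to BG(τ, Ď); since every
-- vertex has at most one edge of each kind, {u,v} is then a 2-cycle component
TwoCycleInBG : ∀ {n} (S : SingGenome n) → SingularizedDupGenome n → Solution S → Vert n → Vert n → Set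
TwoCycleInBG S D τ u v = (partner D u ≡ just v) × (sEdge S τ u ≡ just v)

-- A 0-path is isolated in every BG(τ, Ď): its vertex has no Ď-edge and, being an
-- S-telomere, no S-edge either.
--
-- Let u v be a 2-cycle of ABG(S, Ď) and suppose that the solution τ takes the other
-- pair of S-edges of its square, u v̂ and û v. Then u, v, û, v̂ lie in one component C
-- of BG(τ, Ď). Switching the square leaves every other component unchanged and
-- splits C into the 2-cycle {u, v}, which counts for σ_k since k ≥ 2, and the
-- component of û. If C itself counted, it was a cycle of length at most k, and then
-- the component of û is a shorter cycle, which counts as well. Either way the k-score
-- strictly increases, so τ was not optimal.
--
-- The score is defined through alternating walks. They enumerate the components
-- because the states (vertex, pending side) of a walk evolve by a partial injection
-- whose inverse reverses the side, so a walk cannot revisit a vertex before it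
-- closes up.

module Submission where

open import Defs
open import Data.Bool using (Bool; true; false; if_then_else_; _∧_; not; _xor_; T)
open import Data.Bool.Properties using (T-∧; T-≡)
open import Data.Empty using (⊥; ⊥-elim)
open import Data.Fin using (Fin; toℕ)
open import Data.Fin.Properties using (toℕ-injective) renaming (_≟_ to _≟F_)
open import Data.List using (List; []; _∷_; length; _++_; map; allFin; concatMap; foldr)
open import Data.List.Membership.Propositional using (_∈_; _∉_)
open import Data.List.Membership.Propositional.Properties using (∈-++⁺ˡ; ∈-++⁺ʳ; ∈-++⁻; ∈-allFin; ∈-concatMap⁺)
open import Data.List.Extrema.Nat using (argmin; argmin-sel; f[argmin]≤f[⊤]; f[argmin]≤f[xs])
open import Data.List.Properties using (length-tabulate; map-cong)
open import Data.List.Relation.Binary.Disjoint.Propositional using (Disjoint)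
open import Data.List.Relation.Unary.All as All using ([]; _∷_)
open import Data.List.Relation.Unary.All.Properties using (¬Any⇒All¬)
import Data.List.Relation.Unary.All.Properties as All
import Data.List.Relation.Unary.AllPairs as AllPairs
import Data.List.Relation.Unary.AllPairs.Properties as AllPairs
open import Data.List.Relation.Unary.Any as Any using (here; there; _─_)
open import Data.List.Relation.Unary.Unique.Propositional using (Unique; []; _∷_)
open import Data.List.Relation.Unary.Unique.Propositional.Properties as Unique using (allFin⁺)
import Data.List.Relation.Unary.Unique.Setoid.Properties as UniqueSetoid
open import Data.Maybe using (Maybe; just; nothing; _>>=_)
open import Data.Maybe.Properties using (≡-dec; just-injective)
open import Data.Nat using (ℕ; zero; suc; _+_; _*_; _∸_; _≤_; _<_; z≤n; s≤s; _≤ᵇ_; NonZero)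
open import Data.Nat.DivMod using (_%_; m<n⇒m%n≡m; [m+kn]%n≡m%n)
open import Data.Nat.ListAction using (sum)
open import Data.Nat.Properties
open import Algebra.Properties.CommutativeSemigroup +-commutativeSemigroup using (x∙yz≈y∙xz)
open import Data.Nat.Tactic.RingSolver using (solve-∀)
open import Data.Product using (∃-syntax; _×_; _,_; proj₁; proj₂)
open import Data.Sum using (_⊎_; inj₁; inj₂)
open import Function using (_∘_; id; case_of_; Equivalence)
open import Relation.Binary.PropositionalEquality
open import Relation.Nullary using (Dec; yes; no; ¬_; does)
open import Relation.Nullary.Decidable using (_⊎-dec_; dec-true; dec-false)

divMod-unique : ∀ {d q q′ r r′} .{{_ : NonZero d}} → r < d → r′ < d →
                r + q * d ≡ r′ + q′ * d → r ≡ r′ × q ≡ q′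
divMod-unique {d} {q} {q′} {r} {r′} r<d r′<d eq =
  r≡r′ , *-cancelʳ-≡ q q′ d (+-cancelˡ-≡ r _ _ (trans eq (cong (_+ q′ * d) (sym r≡r′))))
  where
  open ≡-Reasoning
  r≡r′ : r ≡ r′
  r≡r′ = begin
    r                 ≡⟨ m<n⇒m%n≡m r<d ⟨
    r % d             ≡⟨ [m+kn]%n≡m%n r q d ⟨
    (r + q * d) % d   ≡⟨ cong (_% d) eq ⟩
    (r′ + q′ * d) % d ≡⟨ [m+kn]%n≡m%n r′ q′ d ⟩
    r′ % d            ≡⟨ m<n⇒m%n≡m r′<d ⟩
    r′                ∎

>>=-just⁻ : ∀ {A B : Set} (mx : Maybe A) {f : A → Maybe B} {y} → (mx >>= f) ≡ just y →
            ∃[ x ] mx ≡ just x × f x ≡ just y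
>>=-just⁻ (just x) eq = x , refl , eq

module _ {A : Set} where

  ∉⇒unique-∷ : ∀ {x : A} {xs} → x ∉ xs → Unique xs → Unique (x ∷ xs)
  ∉⇒unique-∷ {xs = xs} x∉xs u = ¬Any⇒All¬ xs x∉xs ∷ u

  length-─ : ∀ {x : A} ys (x∈ys : x ∈ ys) → length ys ≡ suc (length (ys ─ x∈ys))
  length-─ (_ ∷ _)  (here _)    = refl
  length-─ (_ ∷ ys) (there x∈ys) = cong suc (length-─ ys x∈ys)

  ∈-─ : ∀ {x y : A} {ys} (x∈ys : x ∈ ys) → y ∈ ys → y ≢ x → y ∈ (ys ─ x∈ys)
  ∈-─ (here refl) (here refl)  y≢x = ⊥-elim (y≢x refl)
  ∈-─ (here _)    (there y∈ys) _   = y∈ys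
  ∈-─ (there _)   (here refl)  _   = here refl
  ∈-─ (there x∈ys) (there y∈ys) y≢x = there (∈-─ x∈ys y∈ys y≢x)

  unique-length-≤ : ∀ {xs ys : List A} → Unique xs → (∀ {z} → z ∈ xs → z ∈ ys) → length xs ≤ length ys
  unique-length-≤ {[]}     _          _   = z≤n
  unique-length-≤ {x ∷ xs} {ys} (x≢xs ∷ u) xs⊆ys = begin
    suc (length xs)          ≤⟨ s≤s (unique-length-≤ u xs⊆ys─x) ⟩
    suc (length (ys ─ x∈ys)) ≡⟨ length-─ ys x∈ys ⟨
    length ys                ∎
    where
    open ≤-Reasoning
    x∈ys = xs⊆ys (here refl)
    xs⊆ys─x : ∀ {z} → z ∈ xs → z ∈ (ys ─ x∈ys)
    xs⊆ys─x z∈xs = ∈-─ x∈ys (xs⊆ys (there z∈xs)) λ { refl → All.lookup x≢xs z∈xs refl }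

  _↾_ : (A → ℕ) → (A → Bool) → A → ℕ
  (f ↾ P) x = if P x then f x else 0

  Σ[_]_ : List A → (A → ℕ) → ℕ
  Σ[ xs ] f = sum (map f xs)

  ↾-on : ∀ f P {x} → P x ≡ true → (f ↾ P) x ≡ f x
  ↾-on f P {x} Px rewrite Px = refl

  ↾-≢0 : ∀ f P {x} → (f ↾ P) x ≢ 0 → P x ≡ true × f x ≢ 0
  ↾-≢0 f P {x} fx≢0 with P x
  ... | true  = refl , fx≢0
  ... | false = ⊥-elim (fx≢0 refl)

  Σ-↾-split : ∀ f P xs → Σ[ xs ] f ≡ Σ[ xs ] (f ↾ P) + Σ[ xs ] (f ↾ (not ∘ P))
  Σ-↾-split f P [] = refl
  Σ-↾-split f P (x ∷ xs) with P x
  ... | true  = trans (cong (f x +_) (Σ-↾-split f P xs)) (sym (+-assoc (f x) _ _))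
  ... | false = trans (cong (f x +_) (Σ-↾-split f P xs)) (x∙yz≈y∙xz (f x) (Σ[ xs ] (f ↾ P)) _)

  Σ-↾-< : ∀ f g P xs → (∀ x → P x ≡ false → f x ≡ g x) →
          Σ[ xs ] (f ↾ P) < Σ[ xs ] (g ↾ P) → Σ[ xs ] f < Σ[ xs ] g
  Σ-↾-< f g P xs f≗g off-P = begin-strict
    Σ[ xs ] f                                      ≡⟨ Σ-↾-split f P xs ⟩
    Σ[ xs ] (f ↾ P) + Σ[ xs ] (f ↾ (not ∘ P))      <⟨ +-monoˡ-< _ off-P ⟩
    Σ[ xs ] (g ↾ P) + Σ[ xs ] (f ↾ (not ∘ P))      ≡⟨ cong (Σ[ xs ] (g ↾ P) +_) (cong sum (map-cong agree xs)) ⟩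
    Σ[ xs ] (g ↾ P) + Σ[ xs ] (g ↾ (not ∘ P))      ≡⟨ Σ-↾-split g P xs ⟨
    Σ[ xs ] g                                      ∎
    where
    open ≤-Reasoning
    agree : ∀ x → (f ↾ (not ∘ P)) x ≡ (g ↾ (not ∘ P)) x
    agree x with P x in eq
    ... | true  = refl
    ... | false = f≗g x eq

  Σ-≡0 : ∀ f xs → (∀ {x} → x ∈ xs → f x ≡ 0) → Σ[ xs ] f ≡ 0
  Σ-≡0 f []       _    = refl
  Σ-≡0 f (x ∷ xs) f≡0 = cong₂ _+_ (f≡0 (here refl)) (Σ-≡0 f xs (f≡0 ∘ there))

  Σ-≥-term : ∀ f {xs x} → x ∈ xs → f x ≤ Σ[ xs ] f
  Σ-≥-term f {x ∷ xs} (here refl) = m≤m+n (f x) _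
  Σ-≥-term f {y ∷ xs} (there x∈xs) = ≤-trans (Σ-≥-term f x∈xs) (m≤n+m _ (f y))

  Σ-≥-two-terms : ∀ f {xs x y} → x ∈ xs → y ∈ xs → x ≢ y → f x + f y ≤ Σ[ xs ] f
  Σ-≥-two-terms f (here refl) (here refl) x≢y = ⊥-elim (x≢y refl)
  Σ-≥-two-terms f {z ∷ _} (here refl) (there y∈xs) _ = +-monoʳ-≤ (f z) (Σ-≥-term f y∈xs)
  Σ-≥-two-terms f {z ∷ _} {x} (there x∈xs) (here refl) _ =
    ≤-trans (≤-reflexive (+-comm (f x) (f z))) (+-monoʳ-≤ (f z) (Σ-≥-term f x∈xs))
  Σ-≥-two-terms f {z ∷ _} (there x∈xs) (there y∈xs) x≢y =
    ≤-trans (Σ-≥-two-terms f x∈xs y∈xs x≢y) (m≤n+m _ (f z))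

  Σ-single-support : ∀ f {xs} → Unique xs →
    (∀ {x y} → x ∈ xs → y ∈ xs → f x ≢ 0 → f y ≢ 0 → x ≡ y) →
    Σ[ xs ] f ≡ 0 ⊎ ∃[ x ] x ∈ xs × Σ[ xs ] f ≡ f x
  Σ-single-support f {[]} _ _ = inj₁ refl
  Σ-single-support f {x ∷ xs} (x≢xs ∷ u) single with f x ≟ 0
  ... | no fx≢0 = inj₂ (x , here refl , trans (cong (f x +_) (Σ-≡0 f xs f≡0)) (+-identityʳ (f x)))
    where
    f≡0 : ∀ {y} → y ∈ xs → f y ≡ 0
    f≡0 {y} y∈xs with f y ≟ 0
    ... | yes fy≡0 = fy≡0
    ... | no fy≢0 = ⊥-elim (All.lookup x≢xs y∈xs (single (here refl) (there y∈xs) fx≢0 fy≢0))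
  ... | yes fx≡0 with Σ-single-support f u (λ p q → single (there p) (there q))
  ...   | inj₁ eq = inj₁ (cong₂ _+_ fx≡0 eq)
  ...   | inj₂ (y , y∈xs , eq) = inj₂ (y , there y∈xs , cong₂ _+_ fx≡0 eq)

_≟C_ : (c c′ : Copy) → Dec (c ≡ c′)
a ≟C a = yes refl
a ≟C b = no λ ()
b ≟C a = no λ ()
b ≟C b = yes refl

_≟E_ : (e e′ : End) → Dec (e ≡ e′)
h ≟E h = yes refl
h ≟E t = no λ ()
t ≟E h = no λ ()
t ≟E t = yes refl

_≟V_ : ∀ {n} (u v : Vert n) → Dec (u ≡ v)
(x , c , e) ≟V (y , c′ , e′) with x ≟F y | c ≟C c′ | e ≟E e′
... | yes refl | yes refl | yes refl = yes refl
... | no x≢y   | _        | _        = no λ { refl → x≢y refl }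
... | yes _    | no c≢c′  | _        = no λ { refl → c≢c′ refl }
... | yes _    | yes _    | no e≢e′  = no λ { refl → e≢e′ refl }

==C-sound : ∀ {c c′} → T (c ==C c′) → c ≡ c′
==C-sound {a} {a} _  = refl
==C-sound {a} {b} ()
==C-sound {b} {a} ()
==C-sound {b} {b} _  = refl

==E-sound : ∀ {e e′} → T (e ==E e′) → e ≡ e′
==E-sound {h} {h} _  = refl
==E-sound {h} {t} ()
==E-sound {t} {h} ()
==E-sound {t} {t} _  = refl

==V-sound : ∀ {n} {u v : Vert n} → (u ==V v) ≡ true → u ≡ v
==V-sound {u = x , c , e} {y , c′ , e′} eq with x ≟F y
... | no _ = case eq of λ ()
... | yes refl with c≡c′ , e≡e′ ← Equivalence.to T-∧ (Equivalence.from T-≡ eq) =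
  cong₂ (λ c e → x , c , e) (==C-sound c≡c′) (==E-sound e≡e′)

==V-refl : ∀ {n} (u : Vert n) → (u ==V u) ≡ true
==V-refl (x , c , e) with x ≟F x
... | no x≢x = ⊥-elim (x≢x refl)
==V-refl (x , a , h) | yes _ = refl
==V-refl (x , a , t) | yes _ = refl
==V-refl (x , b , h) | yes _ = refl
==V-refl (x , b , t) | yes _ = refl

==V-false⇒≢ : ∀ {n} {u v : Vert n} → (u ==V v) ≡ false → u ≢ v
==V-false⇒≢ {u = u} eq refl with () ← trans (sym eq) (==V-refl u)

==V-complete : ∀ {n} {u v : Vert n} → u ≢ v → (u ==V v) ≡ false
==V-complete {u = u} {v} u≢v with u ==V v in eq
... | true  = ⊥-elim (u≢v (==V-sound eq))
... | false = refl

module _ {n : ℕ} where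

  fibre : Fin n → List (Vert n)
  fibre x = (x , a , h) ∷ (x , a , t) ∷ (x , b , h) ∷ (x , b , t) ∷ []

  ∈-fibre : ∀ (v : Vert n) → v ∈ fibre (proj₁ v)
  ∈-fibre (x , a , h) = here refl
  ∈-fibre (x , a , t) = there (here refl)
  ∈-fibre (x , b , h) = there (there (here refl))
  ∈-fibre (x , b , t) = there (there (there (here refl)))

  ∈-fibre⁻ : ∀ {x} {v : Vert n} → v ∈ fibre x → proj₁ v ≡ x
  ∈-fibre⁻ (here refl)                         = refl
  ∈-fibre⁻ (there (here refl))                 = refl
  ∈-fibre⁻ (there (there (here refl)))         = refl
  ∈-fibre⁻ (there (there (there (here refl)))) = refl

  fibre-unique : ∀ x → Unique (fibre x)
  fibre-unique x = ((λ ()) ∷ (λ ()) ∷ (λ ()) ∷ []) ∷ ((λ ()) ∷ (λ ()) ∷ []) ∷ ((λ ()) ∷ []) ∷ [] ∷ []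

  length-concatMap-fibre : ∀ xs → length (concatMap fibre xs) ≡ 4 * length xs
  length-concatMap-fibre []       = refl
  length-concatMap-fibre (x ∷ xs) = trans (cong (4 +_) (length-concatMap-fibre xs)) (sym (*-suc 4 (length xs)))

∈-allVerts : ∀ {n} (v : Vert n) → v ∈ allVerts n
∈-allVerts {n} v = ∈-concatMap⁺ fibre (Any.map (λ { refl → ∈-fibre v }) (∈-allFin (proj₁ v)))

length-allVerts : ∀ n → length (allVerts n) ≡ 4 * n
length-allVerts n = trans (length-concatMap-fibre (allFin n)) (cong (4 *_) (length-tabulate {n = n} (λ x → x)))

allVerts-unique : ∀ n → Unique (allVerts n)
allVerts-unique n = UniqueSetoid.concat⁺ (setoid _)
  (All.map⁺ (All.universal fibre-unique (allFin n)))
  (AllPairs.map⁺ (AllPairs.map (λ x≢y {v} (v∈x , v∈y) → x≢y (trans (sym (∈-fibre⁻ v∈x)) (∈-fibre⁻ v∈y))) (allFin⁺ n)))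

cIdx<2 : ∀ c → cIdx c < 2
cIdx<2 a = s≤s z≤n
cIdx<2 b = s≤s (s≤s z≤n)

eIdx<2 : ∀ e → eIdx e < 2
eIdx<2 h = s≤s z≤n
eIdx<2 t = s≤s (s≤s z≤n)

cIdx-injective : ∀ {c c′} → cIdx c ≡ cIdx c′ → c ≡ c′
cIdx-injective {a} {a} _ = refl
cIdx-injective {b} {b} _ = refl

eIdx-injective : ∀ {e e′} → eIdx e ≡ eIdx e′ → e ≡ e′
eIdx-injective {h} {h} _ = refl
eIdx-injective {t} {t} _ = refl

key-digits : ∀ {n} (x : Fin n) c e → key (x , c , e) ≡ eIdx e + (cIdx c + toℕ x * 2) * 2
key-digits x c e = digits (toℕ x) (cIdx c) (eIdx e)
  where
  digits : ∀ x c e → 4 * x + 2 * c + e ≡ e + (c + x * 2) * 2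
  digits = solve-∀

key-injective : ∀ {n} {v w : Vert n} → key v ≡ key w → v ≡ w
key-injective {v = x , c , e} {y , c′ , e′} eq
  with e≡e′ , rest ← divMod-unique (eIdx<2 e) (eIdx<2 e′)
                       (trans (sym (key-digits x c e)) (trans eq (key-digits y c′ e′)))
  with c≡c′ , x≡y ← divMod-unique (cIdx<2 c) (cIdx<2 c′) rest
  with refl ← toℕ-injective {i = x} {j = y} x≡y
     | refl ← cIdx-injective {c} {c′} c≡c′
     | refl ← eIdx-injective {e} {e′} e≡e′ = refl

keysAbove : ∀ {n} → Vert n → List (Vert n) → Bool
keysAbove v = foldr (λ w r → (key v ≤ᵇ key w) ∧ r) true

keysAbove-sound : ∀ {n} (v : Vert n) l → T (keysAbove v l) → ∀ {y} → y ∈ l → key v ≤ key y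
keysAbove-sound v (w ∷ l) p (here refl) = ≤ᵇ⇒≤ (key v) (key w) (proj₁ (Equivalence.to T-∧ p))
keysAbove-sound v (w ∷ l) p (there y∈)  = keysAbove-sound v l (proj₂ (Equivalence.to T-∧ p)) y∈

keysAbove-complete : ∀ {n} (v : Vert n) l → (∀ {y} → y ∈ l → key v ≤ key y) → T (keysAbove v l)
keysAbove-complete v []      _     = _
keysAbove-complete v (w ∷ l) below =
  Equivalence.from T-∧ (≤⇒≤ᵇ (below (here refl)) , keysAbove-complete v l (below ∘ there))

least-key : ∀ {n} {v : Vert n} {l} → v ∈ l → ∃[ r ] r ∈ l × (∀ {z} → z ∈ l → key r ≤ key z)
least-key {l = x ∷ l} _ = argmin key x l , argmin∈ , least
  where
  argmin∈ : argmin key x l ∈ x ∷ l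
  argmin∈ with argmin-sel key x l
  ... | inj₁ eq = here eq
  ... | inj₂ r∈ = there r∈
  least : ∀ {z} → z ∈ x ∷ l → key (argmin key x l) ≤ key z
  least (here refl) = f[argmin]≤f[⊤] {f = key} x l
  least (there z∈)  = All.lookup (f[argmin]≤f[xs] {f = key} x l) z∈

weightOf : ∀ {n} → KParam → Vert n → CompInfo n → ℕ
weightOf k v ci = if keysAbove v (CompInfo.verts ci) then contrib2 k ci else 0

CountedCycle : ∀ {n} → KParam → CompInfo n → Set
CountedCycle k ci = CompInfo.isCycle ci ≡ true × cycleCounts k (CompInfo.edges ci) ≡ true

contrib2-≤2 : ∀ {n} k (ci : CompInfo n) → contrib2 k ci ≤ 2
contrib2-≤2 k (info true L _) with cycleCounts k L
... | true  = ≤-refl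
... | false = z≤n
contrib2-≤2 k (info false j _) with pathCounts k j
... | true  = s≤s z≤n
... | false = z≤n

contrib2≡2⇒CountedCycle : ∀ {n} k (ci : CompInfo n) → contrib2 k ci ≡ 2 → CountedCycle k ci
contrib2≡2⇒CountedCycle k (info true L _) eq with cycleCounts k L
... | true = refl , refl
contrib2≡2⇒CountedCycle k (info false j _) eq with pathCounts k j
contrib2≡2⇒CountedCycle k (info false j _) () | true
contrib2≡2⇒CountedCycle k (info false j _) () | false

CountedCycle⇒contrib2≡2 : ∀ {n} k (ci : CompInfo n) → CountedCycle k ci → contrib2 k ci ≡ 2
CountedCycle⇒contrib2≡2 k (info true L _) (refl , counts) rewrite counts = refl

cycleCounts-2 : ∀ k → ValidK k → cycleCounts k 2 ≡ true
cycleCounts-2 (fin _) (m , refl) = Equivalence.to T-≡ (≤⇒≤ᵇ (*-monoʳ-≤ 2 (s≤s (z≤n {m}))))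
cycleCounts-2 ∞       _          = refl

cycleCounts-mono : ∀ k {L L′} → cycleCounts k L ≡ true → L′ ≤ L → cycleCounts k L′ ≡ true
cycleCounts-mono (fin K) {L} counts L′≤L =
  Equivalence.to T-≡ (≤⇒≤ᵇ (≤-trans L′≤L (≤ᵇ⇒≤ L K (Equivalence.from T-≡ counts))))
cycleCounts-mono ∞ _ _ = refl

other-involutive : ∀ m → other (other m) ≡ m
other-involutive dSide = refl
other-involutive sSide = refl

other-injective : ∀ {m m′} → other m ≡ other m′ → m ≡ m′
other-injective {dSide} {dSide} _ = refl
other-injective {sSide} {sSide} _ = refl

other-≢ : ∀ m → other m ≢ m
other-≢ dSide ()
other-≢ sSide ()

side-cases : ∀ m m′ → m′ ≡ m ⊎ m′ ≡ other m
side-cases dSide dSide = inj₁ refl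
side-cases dSide sSide = inj₂ refl
side-cases sSide dSide = inj₂ refl
side-cases sSide sSide = inj₁ refl

module Trajectories {n : ℕ} (Dm Sm : Matching (Vert n)) where

  edge : Side → Vert n → Maybe (Vert n)
  edge = edgeOn (partner Dm) (partner Sm)

  edge-sym : ∀ m {x y} → edge m x ≡ just y → edge m y ≡ just x
  edge-sym dSide = partner-sym Dm
  edge-sym sSide = partner-sym Sm

  edge-irrefl : ∀ m x → edge m x ≢ just x
  edge-irrefl dSide = partner-irrefl Dm
  edge-irrefl sSide = partner-irrefl Sm

  -- A state (x , m) is at vertex x, about to leave along an edge of side m.
  State : Set
  State = Vert n × Side

  reverse : State → State
  reverse (x , m) = x , other m

  reverse-involutive : ∀ σ → reverse (reverse σ) ≡ σ
  reverse-involutive (x , m) = cong (x ,_) (other-involutive m)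

  reverse-≢ : ∀ σ → reverse σ ≢ σ
  reverse-≢ (x , m) eq = other-≢ m (cong proj₂ eq)

  advance : Side → Maybe (Vert n) → Maybe State
  advance m nothing  = nothing
  advance m (just y) = just (y , other m)

  step : State → Maybe State
  step (x , m) = advance m (edge m x)

  iter : State → ℕ → Maybe State
  iter σ zero    = just σ
  iter σ (suc i) = step σ >>= λ σ′ → iter σ′ i

  step-just⁻ : ∀ {x m σ} → step (x , m) ≡ just σ → ∃[ y ] edge m x ≡ just y × σ ≡ (y , other m)
  step-just⁻ {x} {m} eq with edge m x
  step-just⁻ refl | just y = y , refl , refl

  step-nothing⁻ : ∀ {x m} → step (x , m) ≡ nothing → edge m x ≡ nothing
  step-nothing⁻ {x} {m} eq with edge m x
  step-nothing⁻ () | just _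
  ... | nothing = refl

  step-of : ∀ {x m y} → edge m x ≡ just y → step (x , m) ≡ just (y , other m)
  step-of eq rewrite eq = refl

  step-injective : ∀ {σ ρ τ} → step σ ≡ just τ → step ρ ≡ just τ → σ ≡ ρ
  step-injective {x , m} {x′ , m′} e e′
    with y , q , refl ← step-just⁻ {x} {m} e | y′ , q′ , eq ← step-just⁻ {x′} {m′} e′
    with refl ← cong proj₁ eq | refl ← other-injective (cong proj₂ eq)
    = cong (_, m) (just-injective (trans (sym (edge-sym m q)) (edge-sym m q′)))

  step-reverse : ∀ {σ τ} → step σ ≡ just τ → step (reverse τ) ≡ just (reverse σ)
  step-reverse {x , m} e with y , q , refl ← step-just⁻ {x} {m} e
    rewrite other-involutive m | edge-sym m q = refl

  iter-+ : ∀ σ i j → iter σ (i + j) ≡ (iter σ i >>= λ ρ → iter ρ j)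
  iter-+ σ zero    j = refl
  iter-+ σ (suc i) j with step σ
  ... | nothing = refl
  ... | just σ′ = iter-+ σ′ i j

  iter-sucʳ : ∀ σ i → iter σ (suc i) ≡ (iter σ i >>= step)
  iter-sucʳ σ zero with step σ
  ... | nothing = refl
  ... | just _  = refl
  iter-sucʳ σ (suc i) with step σ
  ... | nothing = refl
  ... | just σ′ = iter-sucʳ σ′ i

  iter-suc⁻ : ∀ σ i {τ} → iter σ (suc i) ≡ just τ → ∃[ ρ ] iter σ i ≡ just ρ × step ρ ≡ just τ
  iter-suc⁻ σ i eq = >>=-just⁻ (iter σ i) (trans (sym (iter-sucʳ σ i)) eq)

  iter-suc⁺ : ∀ σ i {ρ τ} → iter σ i ≡ just ρ → step ρ ≡ just τ → iter σ (suc i) ≡ just τ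
  iter-suc⁺ σ i e e′ rewrite iter-sucʳ σ i | e = e′

  iter-dead : ∀ σ i {ρ k} → iter σ i ≡ just ρ → step ρ ≡ nothing → i < k → iter σ k ≡ nothing
  iter-dead σ i {ρ} {k} e e′ i<k = begin
    iter σ k                          ≡⟨ cong (iter σ) i+[k∸i]≡k ⟨
    iter σ (i + suc (k ∸ suc i))      ≡⟨ iter-+ σ i (suc (k ∸ suc i)) ⟩
    (iter σ i >>= λ τ → iter τ (suc (k ∸ suc i))) ≡⟨ cong (_>>= λ τ → iter τ (suc (k ∸ suc i))) e ⟩
    (step ρ >>= λ τ → iter τ (k ∸ suc i))         ≡⟨ cong (_>>= λ τ → iter τ (k ∸ suc i)) e′ ⟩
    nothing                           ∎
    where
    open ≡-Reasoning
    i+[k∸i]≡k : i + suc (k ∸ suc i) ≡ k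
    i+[k∸i]≡k = trans (+-suc i (k ∸ suc i)) (m+[n∸m]≡n i<k)

  iter-injective : ∀ i {σ ρ τ} → iter σ i ≡ just τ → iter ρ i ≡ just τ → σ ≡ ρ
  iter-injective zero refl refl = refl
  iter-injective (suc i) {σ} {ρ} e e′
    with σ′ , p , q ← >>=-just⁻ (step σ) e | ρ′ , p′ , q′ ← >>=-just⁻ (step ρ) e′
    with refl ← iter-injective i q q′ = step-injective p p′

  iter-reverse : ∀ i σ τ → iter σ i ≡ just (reverse τ) → iter τ i ≡ just (reverse σ)
  iter-reverse zero σ τ eq = cong just (trans (sym (reverse-involutive τ)) (cong reverse (sym (just-injective eq))))
  iter-reverse (suc i) σ τ eq with σ′ , p , q ← >>=-just⁻ (step σ) eq =
    iter-suc⁺ τ i (iter-reverse i σ′ τ q) (step-reverse p)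

  -- An alternating walk cannot come back to its start with the opposite
  -- side pending: peeling one step off each end gives a shorter such walk,
  -- down to a state equal to its own reverse, or a loop.
  iter-no-flip : ∀ i σ → iter σ i ≢ just (reverse σ)
  iter-no-flip zero σ eq = reverse-≢ σ (sym (just-injective eq))
  iter-no-flip (suc zero) (x , m) eq
    with _ , p , refl ← >>=-just⁻ (step (x , m)) eq
    with _ , q , refl ← step-just⁻ {x} {m} p = edge-irrefl m x q
  iter-no-flip (suc (suc i)) σ eq
    with σ₁ , p , q ← >>=-just⁻ (step σ) eq
    with ρ , r , r′ ← iter-suc⁻ σ₁ i q
    with refl ← just-injective (trans (sym p)
                  (subst (λ τ → step τ ≡ just (reverse ρ)) (reverse-involutive σ) (step-reverse r′)))
    = iter-no-flip i (reverse ρ) (trans r (cong just (sym (reverse-involutive ρ))))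

  iter-reverse-apart-+ : ∀ σ i k {ρ} → iter σ i ≡ just ρ → iter (reverse σ) (k + i) ≡ just ρ → ⊥
  iter-reverse-apart-+ σ i k e e′ with ρ′ , p , q ← >>=-just⁻ (iter (reverse σ) k) (trans (sym (iter-+ _ k i)) e′)
    with refl ← iter-injective i q e = iter-no-flip k (reverse σ) (trans p (cong just (sym (reverse-involutive σ))))

  iter-reverse-apart : ∀ σ i j {ρ} → iter σ i ≡ just ρ → iter (reverse σ) j ≡ just ρ → ⊥
  iter-reverse-apart σ i j e e′ with ≤-total i j
  ... | inj₁ i≤j = iter-reverse-apart-+ σ i (j ∸ i) e (trans (cong (iter (reverse σ)) (m∸n+n≡m i≤j)) e′)
  ... | inj₂ j≤i = iter-reverse-apart-+ (reverse σ) j (i ∸ j) e′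
                     (subst (λ τ → iter τ (i ∸ j + j) ≡ just _) (sym (reverse-involutive σ))
                       (trans (cong (iter σ) (m∸n+n≡m j≤i)) e))

  iter-pred : ∀ σ j {y m} → iter σ (suc j) ≡ just (y , m) →
              ∃[ y′ ] iter σ j ≡ just (y′ , other m) × edge (other m) y ≡ just y′
  iter-pred σ j e with (y′ , m′) , e₁ , e₂ ← iter-suc⁻ σ j e with _ , q , refl ← step-just⁻ {y′} {m′} e₂
    rewrite other-involutive m′ = y′ , e₁ , edge-sym m′ q

  iter-next : ∀ σ i {y m ρ} → iter σ i ≡ just (y , m) → iter σ (suc i) ≡ just ρ → edge m y ≡ just (proj₁ ρ)
  iter-next σ i {y} {m} e e′ with ρ , e₁ , e₂ ← iter-suc⁻ σ i e′ with refl ← trans (sym e) e₁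
    with _ , q , refl ← step-just⁻ {y} {m} e₂ = q

  iter-shift : ∀ σ i k {ρ} → iter σ i ≡ just ρ → iter σ (i + k) ≡ iter ρ k
  iter-shift σ i k e rewrite iter-+ σ i k | e = refl

  iter-return : ∀ σ i k {x m m′} → iter σ i ≡ just (x , m) → iter σ (i + k) ≡ just (x , m′) → iter σ k ≡ just σ
  iter-return σ i k {x} {m} {m′} e e′ with side-cases m m′
  ... | inj₂ refl = ⊥-elim (iter-no-flip k (x , m) (trans (sym (iter-shift σ i k e)) e′))
  ... | inj₁ refl
    with ρ , p , q ← >>=-just⁻ (iter σ k) (trans (sym (iter-+ σ k i)) (trans (cong (iter σ) (+-comm k i)) e′))
    = trans p (cong just (iter-injective i q e))

  infix 4 _⇝_
  data _⇝_ (x : Vert n) : Vert n → Set where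
    ⇝-refl : x ⇝ x
    ⇝-step : ∀ {y z} m → x ⇝ y → edge m y ≡ just z → x ⇝ z

  ⇝-trans : ∀ {x y z} → x ⇝ y → y ⇝ z → x ⇝ z
  ⇝-trans p ⇝-refl         = p
  ⇝-trans p (⇝-step m q e) = ⇝-step m (⇝-trans p q) e

  ⇝-sym : ∀ {x y} → x ⇝ y → y ⇝ x
  ⇝-sym ⇝-refl         = ⇝-refl
  ⇝-sym (⇝-step m p e) = ⇝-trans (⇝-step m ⇝-refl (edge-sym m e)) (⇝-sym p)

  iter-⇝ : ∀ x m i {y m′} → iter (x , m) i ≡ just (y , m′) → x ⇝ y
  iter-⇝ x m zero    refl = ⇝-refl
  iter-⇝ x m (suc i) e with y′ , e₁ , q ← iter-pred (x , m) i e = ⇝-step _ (iter-⇝ x m i e₁) (edge-sym _ q)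

visited : ∀ {A : Set} → Walk A → List A
visited (closed l)  = l
visited (stopped l) = l

visited-consW : ∀ {A : Set} (w : A) r → visited (consW w r) ≡ w ∷ visited r
visited-consW w (closed _)  = refl
visited-consW w (stopped _) = refl

module Components {n : ℕ} (Dm Sm : Matching (Vert n)) where

  open Trajectories Dm Sm public

  alternatingWalk : ℕ → Vert n → Vert n → Side → Walk (Vert n)
  alternatingWalk = walk (partner Dm) (partner Sm)

  F : ℕ
  F = fuel (partner Dm) (partner Sm)

  module WalkFrom (v₀ : Vert n) (m₀ : Side) where

    σ₀ : State
    σ₀ = v₀ , m₀

    Avoids : ℕ → Set
    Avoids p = ∀ k {m} → 0 < k → k ≤ p → iter σ₀ k ≢ just (v₀ , m)

    Ends : ℕ → ℕ → Walk (Vert n) → Set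
    Ends p f (closed l)  = ∃[ m ] iter σ₀ (suc (p + length l)) ≡ just (v₀ , m)
    Ends p f (stopped l) = length l ≡ f ⊎ ∃[ ρ ] iter σ₀ (p + length l) ≡ just ρ × step ρ ≡ nothing

    -- The output of a walk started at step p of the trajectory from σ₀ with fuel f.
    record Traces (p f : ℕ) (r : Walk (Vert n)) : Set where
      field
        avoids  : Avoids (p + length (visited r))
        defined : ∀ i → p < i → i ≤ p + length (visited r) → ∃[ ρ ] iter σ₀ i ≡ just ρ × proj₁ ρ ∈ visited r
        visits  : ∀ {y} → y ∈ visited r → ∃[ i ] ∃[ m ] p < i × i ≤ p + length (visited r) × iter σ₀ i ≡ just (y , m)
        unique  : Unique (visited r)
        ends    : Ends p f r

    avoids-≤ : ∀ {p q} → q ≤ p → Avoids p → Avoids q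
    avoids-≤ q≤p av k k>0 k≤q = av k k>0 (≤-trans k≤q q≤p)

    traces-[] : ∀ p f r → visited r ≡ [] → Avoids p → Ends p f r → Traces p f r
    traces-[] p f r eq av en = record
      { avoids  = avoids-≤ (≤-reflexive p+0≡p) av
      ; defined = λ i p<i i≤ → ⊥-elim (<⇒≱ p<i (≤-trans i≤ (≤-reflexive p+0≡p)))
      ; visits  = λ y∈ → case subst (_ ∈_) eq y∈ of λ ()
      ; unique  = subst Unique (sym eq) []
      ; ends    = en }
      where
      p+0≡p : p + length (visited r) ≡ p
      p+0≡p = trans (cong (λ l → p + length l) eq) (+-identityʳ p)

    traces-∷ : ∀ p f w m r → iter σ₀ (suc p) ≡ just (w , m) → Traces (suc p) f r → Traces p (suc f) (consW w r)
    traces-∷ p f w m r e tr = record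
      { avoids  = subst Avoids (sym len) R.avoids
      ; defined = defined
      ; visits  = visits
      ; unique  = subst Unique (sym (visited-consW w r)) (∉⇒unique-∷ w∉ R.unique)
      ; ends    = ends r R.ends }
      where
      module R = Traces tr
      L = length (visited r)

      len : p + length (visited (consW w r)) ≡ suc p + L
      len = trans (cong (λ l → p + length l) (visited-consW w r)) (+-suc p L)

      ∈-consW : ∀ {y} → y ∈ w ∷ visited r → y ∈ visited (consW w r)
      ∈-consW = subst (_ ∈_) (sym (visited-consW w r))

      defined : ∀ i → p < i → i ≤ p + length (visited (consW w r)) →
                ∃[ ρ ] iter σ₀ i ≡ just ρ × proj₁ ρ ∈ visited (consW w r)
      defined i p<i i≤ with m≤n⇒m<n∨m≡n p<i
      ... | inj₂ refl = (w , m) , e , ∈-consW (here refl)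
      ... | inj₁ sp<i with ρ , e′ , ρ∈ ← R.defined i sp<i (subst (i ≤_) len i≤) = ρ , e′ , ∈-consW (there ρ∈)

      visits : ∀ {y} → y ∈ visited (consW w r) →
               ∃[ i ] ∃[ m′ ] p < i × i ≤ p + length (visited (consW w r)) × iter σ₀ i ≡ just (y , m′)
      visits y∈ with subst (_ ∈_) (visited-consW w r) y∈
      ... | here refl = suc p , m , ≤-refl , subst (suc p ≤_) (sym len) (s≤s (m≤m+n p L)) , e
      ... | there y∈r with i , m′ , sp<i , i≤ , e′ ← R.visits y∈r =
        i , m′ , <-trans (n<1+n p) sp<i , subst (i ≤_) (sym len) i≤ , e′

      w∉ : w ∉ visited r
      w∉ w∈r with i , m′ , sp<i , i≤ , e′ ← R.visits w∈r =
        R.avoids (i ∸ suc p) (m<n⇒0<n∸m sp<i) (≤-trans (m∸n≤m i (suc p)) i≤)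
          (iter-return σ₀ (suc p) (i ∸ suc p) e (trans (cong (iter σ₀) (m+[n∸m]≡n (<⇒≤ sp<i))) e′))

      ends : ∀ r′ → Ends (suc p) f r′ → Ends p (suc f) (consW w r′)
      ends (closed l)  (m′ , e′)           = m′ , trans (cong (λ k → iter σ₀ (suc k)) (+-suc p (length l))) e′
      ends (stopped l) (inj₁ len≡f)        = inj₁ (cong suc len≡f)
      ends (stopped l) (inj₂ (ρ , e₁ , e₂)) = inj₂ (ρ , trans (cong (iter σ₀) (+-suc p (length l))) e₁ , e₂)

    walk-traces : ∀ f p cur m → iter σ₀ p ≡ just (cur , m) → Avoids p → Traces p f (alternatingWalk f v₀ cur m)
    walk-traces zero p cur m e av = traces-[] p zero (stopped []) refl av (inj₁ refl)
    walk-traces (suc f) p cur m e av with edge m cur in eq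
    ... | nothing = traces-[] p (suc f) (stopped []) refl av
                      (inj₂ ((cur , m) , trans (cong (iter σ₀) (+-identityʳ p)) e , cong (advance m) eq))
    ... | just w with w ==V v₀ in w≟v₀
    ...   | true  = traces-[] p (suc f) (closed []) refl av
                      (other m , trans (cong (λ k → iter σ₀ (suc k)) (+-identityʳ p))
                                   (subst (λ z → iter σ₀ (suc p) ≡ just (z , other m)) (==V-sound w≟v₀) e′))
      where e′ = iter-suc⁺ σ₀ p e (step-of eq)
    ...   | false = traces-∷ p f w (other m) _ e′ (walk-traces f (suc p) w (other m) e′ av′)
      where
      e′ : iter σ₀ (suc p) ≡ just (w , other m)
      e′ = iter-suc⁺ σ₀ p e (step-of eq)
      av′ : Avoids (suc p)
      av′ k k>0 k≤ with m≤n⇒m<n∨m≡n k≤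
      ... | inj₁ k<sp = av k k>0 (≤-pred k<sp)
      ... | inj₂ refl = λ e″ → ==V-false⇒≢ w≟v₀ (cong proj₁ (just-injective (trans (sym e′) e″)))

    module Full (r : Walk (Vert n)) (tr : Traces 0 F r) where
      open Traces tr

      L : ℕ
      L = length (visited r)

      on-walk : ∀ j {ρ} → j ≤ L → iter σ₀ j ≡ just ρ → proj₁ ρ ∈ v₀ ∷ visited r
      on-walk zero    _  refl = here refl
      on-walk (suc j) j≤ e with ρ , e′ , ρ∈ ← defined (suc j) (s≤s z≤n) j≤ with refl ← trans (sym e) e′ = there ρ∈

      position : ∀ {y} → y ∈ v₀ ∷ visited r → ∃[ i ] ∃[ m ] i ≤ L × iter σ₀ i ≡ just (y , m)
      position (here refl) = 0 , m₀ , z≤n , refl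
      position (there y∈) with i , m , _ , i≤ , e ← visits y∈ = i , m , i≤ , e

      v₀∉ : v₀ ∉ visited r
      v₀∉ v₀∈ with i , m , 0<i , i≤ , e ← visits v₀∈ = avoids i 0<i i≤ e

      unique-v₀∷ : Unique (v₀ ∷ visited r)
      unique-v₀∷ = ∉⇒unique-∷ v₀∉ unique

      -- The walk visits distinct vertices, so it halts before its fuel 4n runs out.
      fuel-unused : L ≢ F
      fuel-unused L≡F = <-irrefl refl (begin-strict
        L                      <⟨ n<1+n L ⟩
        length (v₀ ∷ visited r) ≤⟨ unique-length-≤ unique-v₀∷ (λ {z} _ → ∈-allVerts z) ⟩
        length (allVerts n)    ≡⟨ length-allVerts n ⟩
        4 * n                  ≡⟨ L≡F ⟨
        L                      ∎)
        where open ≤-Reasoning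

      reachable : ∀ {y} → y ∈ v₀ ∷ visited r → v₀ ⇝ y
      reachable y∈ with i , m , _ , e ← position y∈ = iter-⇝ v₀ m₀ i e

    module Cycle (l : List (Vert n)) (tr : Traces 0 F (closed l)) where
      open Full (closed l) tr

      returns : iter σ₀ (suc L) ≡ just σ₀
      returns with m , e ← Traces.ends tr = iter-return σ₀ 0 (suc L) refl e

      saturated : ∀ {y} → y ∈ v₀ ∷ l → ∀ m → ∃[ z ] edge m y ≡ just z × z ∈ v₀ ∷ l
      saturated y∈ m with position y∈
      ... | i , my , i≤ , e with side-cases my m
      ... | inj₁ refl with m≤n⇒m<n∨m≡n i≤
      ...   | inj₁ i<L with ρ , e′ , ρ∈ ← Traces.defined tr (suc i) (s≤s z≤n) i<L =
        proj₁ ρ , iter-next σ₀ i e e′ , there ρ∈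
      ...   | inj₂ refl = v₀ , iter-next σ₀ i e returns , here refl
      saturated y∈ m | zero , _ , _ , refl | inj₂ refl
        with y′ , e₁ , q ← iter-pred σ₀ L returns = y′ , q , on-walk L ≤-refl e₁
      saturated y∈ m | suc i , _ , i≤ , e | inj₂ refl
        with y′ , e₁ , q ← iter-pred σ₀ i e = y′ , q , on-walk i (≤-trans (n≤1+n i) i≤) e₁

    module Path (l : List (Vert n)) (tr : Traces 0 F (stopped l)) where
      open Full (stopped l) tr

      dead-end : ∃[ ρ ] iter σ₀ L ≡ just ρ × step ρ ≡ nothing
      dead-end with Traces.ends tr
      ... | inj₁ L≡F = ⊥-elim (fuel-unused L≡F)
      ... | inj₂ d   = d

      forward-closed : ∀ i {y m z} → i ≤ L → iter σ₀ i ≡ just (y , m) → edge m y ≡ just z → z ∈ v₀ ∷ l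
      forward-closed i {y} {m} i≤ e q with m≤n⇒m<n∨m≡n i≤
      ... | inj₁ i<L with ρ , e′ , ρ∈ ← Traces.defined tr (suc i) (s≤s z≤n) i<L
        with refl ← trans (sym (iter-next σ₀ i e e′)) q = there ρ∈
      forward-closed i {y} {m} i≤ e q | inj₂ refl with ρ , e₁ , e₂ ← dead-end with refl ← trans (sym e) e₁
        with () ← trans (sym (step-of {y} {m} q)) e₂

      start-closed : ∀ {z} → edge m₀ v₀ ≡ just z → z ∈ v₀ ∷ l
      start-closed = forward-closed 0 z≤n refl

      interior-closed : ∀ {y z} m → y ∈ l → edge m y ≡ just z → z ∈ v₀ ∷ l
      interior-closed m y∈ q with Traces.visits tr y∈
      ... | i , my , _ , i≤ , e with side-cases my m
      ...   | inj₁ refl = forward-closed i i≤ e q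
      interior-closed m y∈ q | suc i , my , _ , i≤ , e | inj₂ refl
        with y′ , e₁ , q′ ← iter-pred σ₀ i e with refl ← trans (sym q′) q = on-walk i (≤-trans (n≤1+n i) i≤) e₁

      never-returns : ∀ k {m} → 0 < k → iter σ₀ k ≢ just (v₀ , m)
      never-returns k 0<k with ≤-<-connex k L
      ... | inj₁ k≤L = Traces.avoids tr k 0<k k≤L
      ... | inj₂ L<k with ρ , e₁ , e₂ ← dead-end = λ e → case trans (sym (iter-dead σ₀ L e₁ e₂ L<k)) e of λ ()

      open-end : ∃[ y ] y ∈ v₀ ∷ l × ∃[ m ] edge m y ≡ nothing
      open-end with (y , m) , e₁ , e₂ ← dead-end = y , on-walk L ≤-refl e₁ , m , step-nothing⁻ e₂

  component : Vert n → CompInfo n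
  component = compOf (partner Dm) (partner Sm)

  members : Vert n → List (Vert n)
  members v = CompInfo.verts (component v)

  record IsComponent (v : Vert n) (ci : CompInfo n) : Set where
    field
      ∈-verts   : v ∈ CompInfo.verts ci
      unique    : Unique (CompInfo.verts ci)
      reachable : ∀ {y} → y ∈ CompInfo.verts ci → v ⇝ y
      edge-closed : ∀ {y z} m → y ∈ CompInfo.verts ci → edge m y ≡ just z → z ∈ CompInfo.verts ci
      cycle-saturated : CompInfo.isCycle ci ≡ true → ∀ {y} → y ∈ CompInfo.verts ci → ∀ m → edge m y ≢ nothing
      cycle-length    : CompInfo.isCycle ci ≡ true → CompInfo.edges ci ≡ length (CompInfo.verts ci)
      path-open       : CompInfo.isCycle ci ≡ false → ∃[ y ] y ∈ CompInfo.verts ci × ∃[ m ] edge m y ≡ nothing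

  data ComponentView (v : Vert n) : CompInfo n → Set where
    cycle-d : ∀ l → alternatingWalk F v v dSide ≡ closed l → ComponentView v (info true (suc (length l)) (v ∷ l))
    cycle-s : ∀ l₀ l → alternatingWalk F v v dSide ≡ stopped l₀ → alternatingWalk F v v sSide ≡ closed l →
              ComponentView v (info true (suc (length l)) (v ∷ l))
    path    : ∀ l l′ → alternatingWalk F v v dSide ≡ stopped l → alternatingWalk F v v sSide ≡ stopped l′ →
              ComponentView v (info false (length l + length l′) (v ∷ l ++ l′))

  component-view : ∀ v → ComponentView v (component v)
  component-view v with alternatingWalk F v v dSide in e
  ... | closed l  = cycle-d l e
  ... | stopped l with alternatingWalk F v v sSide in e′
  ...   | closed l′  = cycle-s l l′ e e′
  ...   | stopped l′ = path l l′ e e′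

  walk-traces₀ : ∀ v m → WalkFrom.Traces v m 0 F (alternatingWalk F v v m)
  walk-traces₀ v m = WalkFrom.walk-traces v m F 0 v m refl λ k k>0 k≤0 → ⊥-elim (<⇒≱ k>0 k≤0)

  traces-of : ∀ v m {r} → alternatingWalk F v v m ≡ r → WalkFrom.Traces v m 0 F r
  traces-of v m eq = subst (WalkFrom.Traces v m 0 F) eq (walk-traces₀ v m)

  cycle-isComponent : ∀ v m l → alternatingWalk F v v m ≡ closed l → IsComponent v (info true (suc (length l)) (v ∷ l))
  cycle-isComponent v m l eq = record
    { ∈-verts   = here refl
    ; unique    = Full.unique-v₀∷
    ; reachable = Full.reachable
    ; edge-closed = cycle-closed
    ; cycle-saturated = λ _ y∈ m e → case trans (sym e) (proj₁ (proj₂ (Cycle.saturated y∈ m))) of λ ()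
    ; cycle-length    = λ _ → refl
    ; path-open       = λ () }
    where
    tr = traces-of v m eq
    module Full = WalkFrom.Full v m (closed l) tr
    module Cycle = WalkFrom.Cycle v m l tr
    cycle-closed : ∀ {y z} m′ → y ∈ v ∷ l → edge m′ y ≡ just z → z ∈ v ∷ l
    cycle-closed m′ y∈ e with z , e′ , z∈ ← Cycle.saturated y∈ m′ with refl ← trans (sym e) e′ = z∈

  path-isComponent : ∀ v l l′ → alternatingWalk F v v dSide ≡ stopped l → alternatingWalk F v v sSide ≡ stopped l′ →
                     IsComponent v (info false (length l + length l′) (v ∷ l ++ l′))
  path-isComponent v l l′ eq eq′ = record
    { ∈-verts   = here refl
    ; unique    = ∉⇒unique-∷ v∉ (Unique.++⁺ (Traces.unique trD) (Traces.unique trS) disjoint)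
    ; reachable = reachable
    ; edge-closed = edge-closed
    ; cycle-saturated = λ ()
    ; cycle-length    = λ ()
    ; path-open       = λ _ → let y , y∈ , m , e = PD.open-end in y , ∈-++⁺ˡ′ y∈ , m , e }
    where
    open WalkFrom using (Traces)
    trD = traces-of v dSide eq
    trS = traces-of v sSide eq′
    module FD = WalkFrom.Full v dSide (stopped l) trD
    module FS = WalkFrom.Full v sSide (stopped l′) trS
    module PD = WalkFrom.Path v dSide l trD
    module PS = WalkFrom.Path v sSide l′ trS

    ∈-++⁺ˡ′ : ∀ {z} → z ∈ v ∷ l → z ∈ v ∷ l ++ l′
    ∈-++⁺ˡ′ (here p)  = here p
    ∈-++⁺ˡ′ (there p) = there (∈-++⁺ˡ p)

    ∈-++⁺ʳ′ : ∀ {z} → z ∈ v ∷ l′ → z ∈ v ∷ l ++ l′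
    ∈-++⁺ʳ′ (here p)  = here p
    ∈-++⁺ʳ′ (there p) = there (∈-++⁺ʳ l p)

    v∉ : v ∉ l ++ l′
    v∉ v∈ with ∈-++⁻ l v∈
    ... | inj₁ p = FD.v₀∉ p
    ... | inj₂ p = FS.v₀∉ p

    -- A vertex on both halves is reached with equal sides (the two half-walks
    -- would meet) or opposite sides (the d-half would return to v).
    disjoint : Disjoint l l′
    disjoint {y} (y∈l , y∈l′)
      with i , m , 0<i , _ , e ← Traces.visits trD y∈l | j , m′ , _ , _ , e′ ← Traces.visits trS y∈l′
      with side-cases m m′
    ... | inj₁ refl = iter-reverse-apart (v , dSide) i j e e′
    ... | inj₂ refl = PD.never-returns (i + j) (<-≤-trans 0<i (m≤m+n i j))
                        (trans (iter-shift (v , dSide) i j e) (iter-reverse j (v , sSide) (y , m) e′))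

    reachable : ∀ {y} → y ∈ v ∷ l ++ l′ → v ⇝ y
    reachable (here refl) = ⇝-refl
    reachable (there y∈) with ∈-++⁻ l y∈
    ... | inj₁ p = FD.reachable (there p)
    ... | inj₂ p = FS.reachable (there p)

    edge-closed : ∀ {y z} m → y ∈ v ∷ l ++ l′ → edge m y ≡ just z → z ∈ v ∷ l ++ l′
    edge-closed dSide (here refl) e = ∈-++⁺ˡ′ (PD.start-closed e)
    edge-closed sSide (here refl) e = ∈-++⁺ʳ′ (PS.start-closed e)
    edge-closed m (there y∈) e with ∈-++⁻ l y∈
    ... | inj₁ p = ∈-++⁺ˡ′ (PD.interior-closed m p e)
    ... | inj₂ p = ∈-++⁺ʳ′ (PS.interior-closed m p e)

  component-isComponent : ∀ v → IsComponent v (component v)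
  component-isComponent v = from-view (component-view v)
    where
    from-view : ∀ {ci} → ComponentView v ci → IsComponent v ci
    from-view (cycle-d l e)     = cycle-isComponent v dSide l e
    from-view (cycle-s _ l _ e) = cycle-isComponent v sSide l e
    from-view (path l l′ e e′)  = path-isComponent v l l′ e e′

  module Component (v : Vert n) = IsComponent (component-isComponent v)

  ⇝⇒∈-members : ∀ {v y} → v ⇝ y → y ∈ members v
  ⇝⇒∈-members {v} ⇝-refl         = Component.∈-verts v
  ⇝⇒∈-members {v} (⇝-step m p e) = Component.edge-closed v m (⇝⇒∈-members p) e

  ∈-members-sym : ∀ {v y} → y ∈ members v → v ∈ members y
  ∈-members-sym {v} y∈ = ⇝⇒∈-members (⇝-sym (Component.reachable v y∈))

  ∈-members-trans : ∀ {v y z} → y ∈ members v → z ∈ members y → z ∈ members v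
  ∈-members-trans {v} {y} y∈ z∈ = ⇝⇒∈-members (⇝-trans (Component.reachable v y∈) (Component.reachable y z∈))

  IsCycle : Vert n → Set
  IsCycle v = CompInfo.isCycle (component v) ≡ true

  cycleLength : Vert n → ℕ
  cycleLength v = CompInfo.edges (component v)

  IsCycle-member : ∀ {v y} → IsCycle v → y ∈ members v → IsCycle y
  IsCycle-member {v} {y} cyc y∈ with CompInfo.isCycle (component y) in eq
  ... | true  = refl
  ... | false with z , z∈ , m , e ← Component.path-open y eq =
    ⊥-elim (Component.cycle-saturated v cyc (∈-members-trans y∈ z∈) m e)

  cycleLength-member : ∀ {v y} → IsCycle v → y ∈ members v → cycleLength y ≤ cycleLength v
  cycleLength-member {v} {y} cyc y∈ = begin
    cycleLength y          ≡⟨ Component.cycle-length y (IsCycle-member cyc y∈) ⟩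
    length (members y)     ≤⟨ unique-length-≤ (Component.unique y) (∈-members-trans y∈) ⟩
    length (members v)     ≡⟨ Component.cycle-length v cyc ⟨
    cycleLength v          ∎
    where open ≤-Reasoning

  isRepresentative : Vert n → Bool
  isRepresentative = isRep (partner Dm) (partner Sm)

  representative-exists : ∀ v → ∃[ r ] r ∈ members v × T (isRepresentative r)
  representative-exists v with r , r∈ , least ← least-key (Component.∈-verts v) =
    r , r∈ , keysAbove-complete r (members r) (least ∘ ∈-members-trans r∈)

  weight : KParam → Vert n → ℕ
  weight k v = weightOf k v (component v)

  weight-≤2 : ∀ k v → weight k v ≤ 2
  weight-≤2 k v with isRepresentative v
  ... | true  = contrib2-≤2 k (component v)
  ... | false = z≤n

  weight≢0⇒representative : ∀ k v → weight k v ≢ 0 → T (isRepresentative v)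
  weight≢0⇒representative k v w≢0 with isRepresentative v
  ... | true  = _
  ... | false = w≢0 refl

  weight≡2⇒CountedCycle : ∀ k v → weight k v ≡ 2 → CountedCycle k (component v)
  weight≡2⇒CountedCycle k v w≡2 with isRepresentative v
  ... | true = contrib2≡2⇒CountedCycle k (component v) w≡2

  -- Only the vertex of least key carries weight, and keys are injective.
  weight-unique : ∀ k {v y z} → y ∈ members v → z ∈ members v → weight k y ≢ 0 → weight k z ≢ 0 → y ≡ z
  weight-unique k {v} {y} {z} y∈ z∈ wy wz = key-injective (≤-antisym (below y∈ z∈ wy) (below z∈ y∈ wz))
    where
    below : ∀ {y z} → y ∈ members v → z ∈ members v → weight k y ≢ 0 → key y ≤ key z
    below {y} y∈ z∈ wy = keysAbove-sound y (members y) (weight≢0⇒representative k y wy)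
                           (∈-members-trans (∈-members-sym y∈) z∈)

  CountedCycle-member : ∀ k {v y} → CountedCycle k (component v) → y ∈ members v → CountedCycle k (component y)
  CountedCycle-member k (cyc , counts) y∈ =
    IsCycle-member cyc y∈ , cycleCounts-mono k counts (cycleLength-member cyc y∈)

  CountedCycle⇒weight-2 : ∀ k v → CountedCycle k (component v) → ∃[ r ] r ∈ members v × weight k r ≡ 2
  CountedCycle⇒weight-2 k v counted with r , r∈ , rep ← representative-exists v = r , r∈ , weight-r
    where
    weight-r : weight k r ≡ 2
    weight-r with isRepresentative r
    ... | true = CountedCycle⇒contrib2≡2 k (component r) (CountedCycle-member k counted r∈)

walk-local : ∀ {n} (d s s′ : Vert n → Maybe (Vert n)) f v₀ cur m →
             (∀ {z} → z ∈ cur ∷ visited (walk d s f v₀ cur m) → s z ≡ s′ z) →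
             walk d s f v₀ cur m ≡ walk d s′ f v₀ cur m
walk-local d s s′ zero v₀ cur m agree = refl
walk-local d s s′ (suc f) v₀ cur dSide agree with d cur
... | nothing = refl
... | just w with w ==V v₀
...   | true  = refl
...   | false = cong (consW w) (walk-local d s s′ f v₀ w sSide
                  (agree ∘ there ∘ subst (_ ∈_) (sym (visited-consW w (walk d s f v₀ w sSide)))))
walk-local d s s′ (suc f) v₀ cur sSide agree rewrite sym (agree (here refl)) with s cur
... | nothing = refl
... | just w with w ==V v₀
...   | true  = refl
...   | false = cong (consW w) (walk-local d s s′ f v₀ w dSide
                  (agree ∘ there ∘ subst (_ ∈_) (sym (visited-consW w (walk d s f v₀ w dSide)))))

compOf-cong : ∀ {n} (d s s′ : Vert n → Maybe (Vert n)) v →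
              walk d s (4 * n) v v dSide ≡ walk d s′ (4 * n) v v dSide →
              walk d s (4 * n) v v sSide ≡ walk d s′ (4 * n) v v sSide → compOf d s v ≡ compOf d s′ v
compOf-cong {n} d s s′ v e₁ e₂ with walk d s (4 * n) v v dSide | walk d s′ (4 * n) v v dSide | e₁
... | closed l  | _ | refl = refl
... | stopped l | _ | refl with walk d s (4 * n) v v sSide | walk d s′ (4 * n) v v sSide | e₂
...   | closed l′  | _ | refl = refl
...   | stopped l′ | _ | refl = refl

closed-walk⇒compOf : ∀ {n} (d s : Vert n → Maybe (Vert n)) v {l} → walk d s (4 * n) v v dSide ≡ closed l →
                     compOf d s v ≡ info true (suc (length l)) (v ∷ l)
closed-walk⇒compOf {n} d s v eq with walk d s (4 * n) v v dSide | eq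
... | closed l | refl = refl

compOf-2-cycle : ∀ {n} (d s : Vert n → Maybe (Vert n)) {u v : Vert n} → d u ≡ just v → s v ≡ just u → v ≢ u →
                 compOf d s u ≡ info true 2 (u ∷ v ∷ [])
compOf-2-cycle {suc n} d s {u} {v} du sv v≢u =
  closed-walk⇒compOf d s u
    (subst (λ f → walk d s f u u dSide ≡ closed (v ∷ [])) (sym (*-suc 4 n)) (two-steps (2 + 4 * n)))
  where
  two-steps : ∀ f → walk d s (suc (suc f)) u u dSide ≡ closed (v ∷ [])
  two-steps f rewrite du | ==V-complete v≢u | sv | ==V-refl u = refl

component-local : ∀ {n} (Dm Sm Sm′ : Matching (Vert n)) v →
  (∀ {z} → z ∈ Components.members Dm Sm v → partner Sm z ≡ partner Sm′ z) →
  Components.component Dm Sm v ≡ Components.component Dm Sm′ v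
component-local Dm Sm Sm′ v agree = compOf-cong (partner Dm) (partner Sm) (partner Sm′) v (local dSide) (local sSide)
  where
  open Components Dm Sm
  local : ∀ m → alternatingWalk F v v m ≡ walk (partner Dm) (partner Sm′) F v v m
  local m = walk-local (partner Dm) (partner Sm) (partner Sm′) F v v m
              (agree ∘ ⇝⇒∈-members ∘ WalkFrom.Full.reachable v m _ (walk-traces₀ v m))

flipC-involutive : ∀ c → flipC (flipC c) ≡ c
flipC-involutive a = refl
flipC-involutive b = refl

flipC-≢ : ∀ c → flipC c ≢ c
flipC-≢ a ()
flipC-≢ b ()

copy-cases : ∀ c c′ → c′ ≡ c ⊎ c′ ≡ flipC c
copy-cases a a = inj₁ refl
copy-cases a b = inj₂ refl
copy-cases b a = inj₂ refl
copy-cases b b = inj₁ refl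

orient : Bool → Copy → Copy
orient β c = if β then c else flipC c

orient-flipC : ∀ β c → orient β (flipC c) ≡ flipC (orient β c)
orient-flipC true  c = refl
orient-flipC false c = refl

orient-not : ∀ β c → orient (not β) c ≡ flipC (orient β c)
orient-not true  c = refl
orient-not false c = sym (flipC-involutive c)

_≟X_ : ∀ {n} (γ δ : Ext n) → Dec (γ ≡ δ)
(x , e) ≟X (y , e′) with x ≟F y | e ≟E e′
... | yes refl | yes refl = yes refl
... | no x≢y   | _        = no λ { refl → x≢y refl }
... | yes _    | no e≢e′  = no λ { refl → e≢e′ refl }

module _ {n} (S : SingGenome n) where

  sEdge-just : ∀ τ {x c e y e′} → partner S (x , e) ≡ just (y , e′) →
               sEdge S τ (x , c , e) ≡ just (y , orient (choice τ (x , e)) c , e′)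
  sEdge-just τ eq rewrite eq = refl

  sEdge-nothing : ∀ τ w → partner S (ext w) ≡ nothing → sEdge S τ w ≡ nothing
  sEdge-nothing τ (x , c , e) eq rewrite eq = refl

  sEdge-nothing⁻ : ∀ τ w → sEdge S τ w ≡ nothing → partner S (ext w) ≡ nothing
  sEdge-nothing⁻ τ (x , c , e) eq with partner S (x , e)
  ... | nothing = refl

  sEdge-ext : ∀ τ w {z} → sEdge S τ w ≡ just z → partner S (ext w) ≡ just (ext z)
  sEdge-ext τ (x , c , e) eq with partner S (x , e)
  sEdge-ext τ (x , c , e) refl | just _ = refl

  sEdge-cong : ∀ τ τ′ w → choice τ (ext w) ≡ choice τ′ (ext w) → sEdge S τ w ≡ sEdge S τ′ w
  sEdge-cong τ τ′ (x , c , e) eq with partner S (x , e)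
  ... | nothing = refl
  ... | just (y , e′) = cong (λ β → just (y , orient β c , e′)) eq

  sEdge-sym : ∀ τ {w z} → sEdge S τ w ≡ just z → sEdge S τ z ≡ just w
  sEdge-sym τ {x , c , e} eq with partner S (x , e) in ps
  sEdge-sym τ {x , c , e} refl | just (y , e′) =
    trans (sEdge-just τ (partner-sym S ps))
      (cong (λ c′ → just (x , c′ , e)) (orient-twice (consistent τ (partner-sym S ps))))
    where
    orient-twice : ∀ {β β′} → β′ ≡ β → orient β′ (orient β c) ≡ c
    orient-twice {true}  refl = refl
    orient-twice {false} refl = flipC-involutive c

  sEdge-irrefl : ∀ τ w → sEdge S τ w ≢ just w
  sEdge-irrefl τ w eq = partner-irrefl S (ext w) (sEdge-ext τ w eq)

  chosenEdges : Solution S → Matching (Vert n)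
  chosenEdges τ = record { partner = sEdge S τ ; partner-sym = sEdge-sym τ ; partner-irrefl = sEdge-irrefl τ }

  OnSquare : Ext n → Ext n → Ext n → Set
  OnSquare γ δ ε = ε ≡ γ ⊎ ε ≡ δ

  onSquare? : ∀ γ δ ε → Dec (OnSquare γ δ ε)
  onSquare? γ δ ε = (ε ≟X γ) ⊎-dec (ε ≟X δ)

  module _ {γ δ} (γδ : partner S γ ≡ just δ) where

    partner-OnSquare : ∀ {ε ε′} → partner S ε ≡ just ε′ → OnSquare γ δ ε → OnSquare γ δ ε′
    partner-OnSquare εε′ (inj₁ refl) = inj₂ (just-injective (trans (sym εε′) γδ))
    partner-OnSquare εε′ (inj₂ refl) = inj₁ (just-injective (trans (sym εε′) (partner-sym S γδ)))

    onSquare-partner : ∀ {ε ε′} → partner S ε ≡ just ε′ → does (onSquare? γ δ ε) ≡ does (onSquare? γ δ ε′)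
    onSquare-partner {ε} {ε′} εε′ = case onSquare? γ δ ε of λ where
      (yes p) → trans (dec-true (onSquare? γ δ ε) p) (sym (dec-true (onSquare? γ δ ε′) (partner-OnSquare εε′ p)))
      (no ¬p) → trans (dec-false (onSquare? γ δ ε) ¬p)
                  (sym (dec-false (onSquare? γ δ ε′) (¬p ∘ partner-OnSquare (partner-sym S εε′))))

    flipSquare : Solution S → Solution S
    flipSquare τ = record
      { choice     = λ ε → does (onSquare? γ δ ε) xor choice τ ε
      ; consistent = λ εε′ → cong₂ _xor_ (onSquare-partner εε′) (consistent τ εε′) }

    flipSquare-on : ∀ τ → choice (flipSquare τ) γ ≡ not (choice τ γ)
    flipSquare-on τ = cong (_xor choice τ γ) (dec-true (onSquare? γ δ γ) (inj₁ refl))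

    flipSquare-off : ∀ τ {ε} → ¬ OnSquare γ δ ε → choice (flipSquare τ) ε ≡ choice τ ε
    flipSquare-off τ {ε} off = cong (_xor choice τ ε) (dec-false (onSquare? γ δ ε) off)

module SquareFlip {n} (S : SingGenome n) (D : SingularizedDupGenome n) (k : KParam) (valid : ValidK k)
  (τ : Solution S) {x y : Fin n} {c c′ : Copy} {e e′ : End}
  (Du : partner D (x , c , e) ≡ just (y , c′ , e′)) (Su : partner S (x , e) ≡ just (y , e′))
  (misses : sEdge S τ (x , c , e) ≢ just (y , c′ , e′)) where

  open import Data.List.Membership.DecPropositional (_≟V_ {n}) using (_∈?_)

  u v û v̂ : Vert n
  u = x , c , e
  v = y , c′ , e′
  û = x , flipC c , e
  v̂ = y , flipC c′ , e′

  τ′ : Solution S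
  τ′ = flipSquare S Su τ

  module G  = Components D (chosenEdges S τ)
  module G′ = Components D (chosenEdges S τ′)

  orient-u : orient (choice τ (x , e)) c ≡ flipC c′
  orient-u with copy-cases c′ (orient (choice τ (x , e)) c)
  ... | inj₁ eq = ⊥-elim (misses (trans (sEdge-just S τ Su) (cong (λ c″ → just (y , c″ , e′)) eq)))
  ... | inj₂ eq = eq

  τ-u : sEdge S τ u ≡ just v̂
  τ-u = trans (sEdge-just S τ Su) (cong (λ c″ → just (y , c″ , e′)) orient-u)

  τ-û : sEdge S τ û ≡ just v
  τ-û = trans (sEdge-just S τ Su) (cong (λ c″ → just (y , c″ , e′))
          (trans (orient-flipC (choice τ (x , e)) c) (trans (cong flipC orient-u) (flipC-involutive c′))))

  τ′-u : sEdge S τ′ u ≡ just v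
  τ′-u = trans (sEdge-just S τ′ Su) (cong (λ c″ → just (y , c″ , e′))
           (trans (cong (λ β → orient β c) (flipSquare-on S Su τ))
             (trans (orient-not (choice τ (x , e)) c) (trans (cong flipC orient-u) (flipC-involutive c′)))))

  v≢u : v ≢ u
  v≢u refl = partner-irrefl D u Du

  û≢u : û ≢ u
  û≢u eq = flipC-≢ c (cong (proj₁ ∘ proj₂) eq)

  û≢v : û ≢ v
  û≢v eq = partner-irrefl S (x , e) (subst (λ z → partner S (x , e) ≡ just z) (sym (cong ext eq)) Su)

  C : List (Vert n)
  C = G.members u

  u∈C : u ∈ C
  u∈C = G.Component.∈-verts u

  v∈C : v ∈ C
  v∈C = G.Component.edge-closed u dSide u∈C Du

  square⊆C : ∀ z → OnSquare S (x , e) (y , e′) (ext z) → z ∈ C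
  square⊆C (_ , c₀ , _) (inj₁ refl) with copy-cases c c₀
  ... | inj₁ refl = u∈C
  ... | inj₂ refl = G.Component.edge-closed u sSide v∈C (sEdge-sym S τ τ-û)
  square⊆C (_ , c₀ , _) (inj₂ refl) with copy-cases c′ c₀
  ... | inj₁ refl = v∈C
  ... | inj₂ refl = G.Component.edge-closed u sSide u∈C τ-u

  same-off-square : ∀ z → ¬ OnSquare S (x , e) (y , e′) (ext z) → sEdge S τ z ≡ sEdge S τ′ z
  same-off-square z off = sEdge-cong S τ τ′ z (sym (flipSquare-off S Su τ off))

  weight-outside : ∀ w → w ∉ C → G′.weight k w ≡ G.weight k w
  weight-outside w w∉C = cong (weightOf k w) (sym (component-local D (chosenEdges S τ) (chosenEdges S τ′) w agree))
    where
    agree : ∀ {z} → z ∈ G.members w → sEdge S τ z ≡ sEdge S τ′ z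
    agree {z} z∈ with onSquare? S (x , e) (y , e′) (ext z)
    ... | yes on = ⊥-elim (w∉C (G.∈-members-trans (square⊆C z on) (G.∈-members-sym z∈)))
    ... | no off = same-off-square z off

  component′-u : G′.component u ≡ info true 2 (u ∷ v ∷ [])
  component′-u = compOf-2-cycle (partner D) (sEdge S τ′) Du (sEdge-sym S τ′ τ′-u) v≢u

  members′-u : G′.members u ≡ u ∷ v ∷ []
  members′-u = cong CompInfo.verts component′-u

  members′-û⊆C : ∀ {z} → z ∈ G′.members û → z ∈ C
  members′-û⊆C = reach⊆C ∘ G′.Component.reachable û
    where
    reach⊆C : ∀ {z} → û G′.⇝ z → z ∈ C
    reach⊆C G′.⇝-refl = square⊆C û (inj₁ refl)
    reach⊆C (G′.⇝-step dSide p q) = G.Component.edge-closed u dSide (reach⊆C p) q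
    reach⊆C (G′.⇝-step {z₀} {z} sSide p q) with onSquare? S (x , e) (y , e′) (ext z₀)
    ... | yes on = square⊆C z (partner-OnSquare S Su (sEdge-ext S τ′ z₀ q) on)
    ... | no off = G.Component.edge-closed u sSide (reach⊆C p) (trans (same-off-square z₀ off) q)

  ∉members′-û : ∀ {w} → w ∈ G′.members u → w ∉ G′.members û
  ∉members′-û w∈ w∈′ with subst (û ∈_) members′-u (G′.∈-members-trans w∈ (G′.∈-members-sym w∈′))
  ... | here eq         = û≢u eq
  ... | there (here eq) = û≢v eq

  IsCycle′-û : G.IsCycle u → G′.IsCycle û
  IsCycle′-û cyc with CompInfo.isCycle (G′.component û) in eq
  ... | true = refl
  ... | false with z , z∈ , m , open-m ← G′.Component.path-open û eq =
    ⊥-elim (G.Component.cycle-saturated u cyc (members′-û⊆C z∈) m (open-in-G m open-m))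
    where
    open-in-G : ∀ m → G′.edge m z ≡ nothing → G.edge m z ≡ nothing
    open-in-G dSide = id
    open-in-G sSide = sEdge-nothing S τ z ∘ sEdge-nothing⁻ S τ′ z

  u∷v∷members′-û-unique : Unique (u ∷ v ∷ G′.members û)
  u∷v∷members′-û-unique =
    ∉⇒unique-∷ (λ { (here eq) → v≢u (sym eq) ; (there p) → ∉members′-û u∈′ p })
      (∉⇒unique-∷ (∉members′-û v∈′) (G′.Component.unique û))
    where
    u∈′ = subst (u ∈_) (sym members′-u) (here refl)
    v∈′ = subst (v ∈_) (sym members′-u) (there (here refl))

  u∷v∷members′-û⊆C : ∀ {z} → z ∈ u ∷ v ∷ G′.members û → z ∈ C
  u∷v∷members′-û⊆C (here refl)         = u∈C
  u∷v∷members′-û⊆C (there (here refl)) = v∈C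
  u∷v∷members′-û⊆C (there (there z∈))  = members′-û⊆C z∈

  cycleLength′-û-≤ : (cyc : G.IsCycle u) → G′.cycleLength û ≤ G.cycleLength u
  cycleLength′-û-≤ cyc = begin
    G′.cycleLength û               ≡⟨ G′.Component.cycle-length û (IsCycle′-û cyc) ⟩
    length (G′.members û)          ≤⟨ m≤n+m _ 2 ⟩
    length (u ∷ v ∷ G′.members û)  ≤⟨ unique-length-≤ u∷v∷members′-û-unique u∷v∷members′-û⊆C ⟩
    length C                       ≡⟨ G.Component.cycle-length u cyc ⟨
    G.cycleLength u                ∎
    where open ≤-Reasoning

  countedCycle′-û : CountedCycle k (G.component u) → CountedCycle k (G′.component û)
  countedCycle′-û (cyc , counts) = IsCycle′-û cyc , cycleCounts-mono k counts (cycleLength′-û-≤ cyc)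

  inC : Vert n → Bool
  inC w = does (w ∈? C)

  inC⁺ : ∀ {w} → w ∈ C → inC w ≡ true
  inC⁺ {w} = dec-true (w ∈? C)

  inC⁻ : ∀ {w} → inC w ≡ false → w ∉ C
  inC⁻ {w} off w∈ = case trans (sym off) (inC⁺ w∈) of λ ()

  inC-sound : ∀ {w} → inC w ≡ true → w ∈ C
  inC-sound {w} on with w ∈? C
  ... | yes w∈ = w∈

  old new : ℕ
  old = Σ[ allVerts n ] (G.weight k ↾ inC)
  new = Σ[ allVerts n ] (G′.weight k ↾ inC)

  old-support-single : ∀ {w w′} → w ∈ allVerts n → w′ ∈ allVerts n →
                       (G.weight k ↾ inC) w ≢ 0 → (G.weight k ↾ inC) w′ ≢ 0 → w ≡ w′
  old-support-single _ _ ww ww′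
    with w∈ , w≢0 ← ↾-≢0 (G.weight k) inC ww | w′∈ , w′≢0 ← ↾-≢0 (G.weight k) inC ww′ =
    G.weight-unique k (inC-sound w∈) (inC-sound w′∈) w≢0 w′≢0

  old-single : old ≡ 0 ⊎ ∃[ w ] w ∈ C × old ≡ G.weight k w
  old-single with Σ-single-support (G.weight k ↾ inC) (allVerts-unique n) old-support-single
  ... | inj₁ old≡0 = inj₁ old≡0
  ... | inj₂ (w , _ , eq) with w ∈? C
  ...   | yes w∈ = inj₂ (w , w∈ , eq)
  ...   | no _   = inj₁ eq

  new-at : ∀ {r} → r ∈ C → (G′.weight k ↾ inC) r ≡ G′.weight k r
  new-at r∈ = ↾-on (G′.weight k) inC (inC⁺ r∈)

  new-≥ : ∀ {r} → r ∈ C → G′.weight k r ≤ new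
  new-≥ r∈ = subst (_≤ new) (new-at r∈) (Σ-≥-term (G′.weight k ↾ inC) (∈-allVerts _))

  new-≥₂ : ∀ {r r′} → r ∈ C → r′ ∈ C → r ≢ r′ → G′.weight k r + G′.weight k r′ ≤ new
  new-≥₂ r∈ r′∈ r≢r′ =
    subst (_≤ new) (cong₂ _+_ (new-at r∈) (new-at r′∈))
      (Σ-≥-two-terms (G′.weight k ↾ inC) (∈-allVerts _) (∈-allVerts _) r≢r′)

  members′-u⊆C : ∀ {z} → z ∈ G′.members u → z ∈ C
  members′-u⊆C z∈ with subst (_ ∈_) members′-u z∈
  ... | here refl         = u∈C
  ... | there (here refl) = v∈C

  two-cycle-weight : ∃[ r ] r ∈ G′.members u × G′.weight k r ≡ 2
  two-cycle-weight =
    G′.CountedCycle⇒weight-2 k u (subst (CountedCycle k) (sym component′-u) (refl , cycleCounts-2 k valid))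

  new-≥2 : 2 ≤ new
  new-≥2 with r , r∈ , w ← two-cycle-weight = subst (_≤ new) w (new-≥ (members′-u⊆C r∈))

  -- If C was a counted cycle, the new 2-cycle and the rest of C are both counted cycles.
  new-≥4 : CountedCycle k (G.component u) → 4 ≤ new
  new-≥4 counted
    with r , r∈ , w ← two-cycle-weight | r′ , r′∈ , w′ ← G′.CountedCycle⇒weight-2 k û (countedCycle′-û counted) =
    subst (_≤ new) (cong₂ _+_ w w′) (new-≥₂ (members′-u⊆C r∈) (members′-û⊆C r′∈) λ { refl → ∉members′-û r∈ r′∈ })

  old<new : old < new
  old<new with old-single
  ... | inj₁ old≡0 rewrite old≡0 = <-≤-trans (s≤s z≤n) new-≥2
  ... | inj₂ (w , w∈ , eq) rewrite eq with G.weight k w ≟ 2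
  ...   | yes w≡2 rewrite w≡2 =
    ≤-trans (n≤1+n 3) (new-≥4 (G.CountedCycle-member k (G.weight≡2⇒CountedCycle k w w≡2) (G.∈-members-sym w∈)))
  ...   | no w≢2 = <-≤-trans (≤∧≢⇒< (G.weight-≤2 k w) w≢2) new-≥2

  improves : twiceScore k S D τ < twiceScore k S D τ′
  improves = Σ-↾-< (G.weight k) (G′.weight k) inC (allVerts n) (λ w off → sym (weight-outside w (inC⁻ off))) old<new

optimal-chooses-2-cycle : ∀ {n} (S : SingGenome n) (D : SingularizedDupGenome n) k → ValidK k →
  (τ : Solution S) → Optimal k S D τ → ∀ {u v} → partner D u ≡ just v → partner S (ext u) ≡ just (ext v) →
  sEdge S τ u ≡ just v
optimal-chooses-2-cycle S D k valid τ opt {u} {v} Du Su with ≡-dec _≟V_ (sEdge S τ u) (just v)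
... | yes chosen = chosen
... | no misses  = ⊥-elim (<⇒≱ (SquareFlip.improves S D k valid τ Du Su misses) (opt _))

lemma1 : (n : ℕ) (S : SingGenome n) (D : SingularizedDupGenome n) (k : KParam) → ValidK k →
           (τ : Solution S) → Optimal k S D τ →
           ((v : Vert n) → ZeroPath S D v → IsolatedInBG S D τ v)
           × ((u v : Vert n) → TwoCycle S D u v → TwoCycleInBG S D τ u v)
lemma1 n S D k valid τ opt =
  (λ v (S-telomere , D-telomere) → D-telomere , sEdge-nothing S τ v S-telomere) ,
  (λ u v (Du , Su) → Du , optimal-chooses-2-cycle S D k valid τ opt Du Su)
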